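{- Let $f$, $G_1,\dots,G_t$, $h$, the partial order $\preceq$ and the set $\Omega$ of maximal antichains be as in the context. Then every admissible fixed point of $h$ is regular, and the number of fixed points of $f$ is $$\sum_{\emptyset\neq\mathcal{J}\subseteq\Omega}(-1)^{|\mathcal{J}|+1}\,2^{\left|\bigcap_{J\in\mathcal{J}}J\right|}.$$
   Context: $\mathbb{F}_2=\{0,1\}$. A conjunctive Boolean network is a map $f=(f_1,\dots,f_n):\mathbb{F}_2^n\to\mathbb{F}_2^n$ where each $f_i$ is a product (AND) of a nonempty set of variables; its dependency graph $\mathfrak{D}(f)$ has vertices $1,\dots,n$ and an edge $i\to j$ iff $x_i$ appears in $f_j$. Let $G_1,\dots,G_t$ be the strongly connected components of $\mathfrak{D}(f)$ (induced subgraphs on mutual-reachability classes), each assumed to contain at least one edge; $h$ is the conjunctive network on $n$ nodes whose dependency graph is the disjoint union of $G_1,\dots,G_t$. Partial order on $[t]$: $G_i\preceq G_j$ iff there is a directed path in $\mathfrak{D}(f)$ from a vertex of $G_i$ to a vertex of $G_j$ (reflexive); $\prec$ is the strict version; $\Omega$ is the set of maximal antichains $J\subseteq[t]$. For $K\subseteq[t]$: $K^{\preceq}=\{k:G_j\preceq G_k,\ j\in K\}$, $K^{\succeq}=\{k:G_k\preceq G_j,\ j\in K\}$, $K^{\prec}=\{k:G_j\prec G_k,\ j\in K\}$, $K^{\succ}=\{k:G_k\prec G_j,\ j\in K\}$. A fixed point $\mathbf{u}$ of $h$ is $K_0$ (resp. $K_1$) if all coordinates of $\mathbf{u}$ at vertices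 of $G_k$, $k\in K$, are $0$ (resp. $1$). It is admissible if for every $j$: $\{j\}_0$ implies $(\{j\}^{\preceq})_0$, and $\{j\}_1$ implies $(\{j\}^{\succeq})_1$. It is regular if for some $J\in\Omega$ it is both $(J^{\prec})_0$ and $(J^{\succ})_1$. -}

module Defs where

open import Data.Bool using (Bool; true; false; _∧_; _∨_; not)
open import Data.Nat using (ℕ; zero; suc)
open import Data.Fin using (Fin)
import Data.Fin
open import Relation.Nullary.Decidable using (⌊_⌋)
open import Data.Fin.Subset using (Subset; _∈_; _⊆_; Nonempty; ⋂; ∣_∣)
open import Data.Vec using (Vec; tabulate; lookup)
open import Data.List using (List; []; _∷_; [_]; _++_; map; length; foldr)
open import Data.Integer using (ℤ; +_; -_; _+_; _*_; _^_)
open import Data.Product using (Σ; ∃; ∃₂; _×_; _,_)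
open import Relation.Binary.PropositionalEquality using (_≡_; _≢_)
open import Relation.Binary.Construct.Closure.ReflexiveTransitive using (Star)

-- A conjunctive Boolean network on n nodes is given by its input sets:
-- S j is the (nonempty) set of variables occurring in f_j.
-- AND of x_i over i in a subset s of Fin n.
conjOver : ∀ {n} → Subset n → Vec Bool n → Bool
conjOver {n} s x = Data.List.foldr _∧_ true
  (Data.List.tabulate {n = n} (λ i → not (lookup s i) ∨ lookup x i))

network : ∀ {n} → (Fin n → Subset n) → Vec Bool n → Vec Bool n
network S x = tabulate (λ j → conjOver (S j) x)

Edge : ∀ {n} → (Fin n → Subset n) → Fin n → Fin n → Set
Edge S i j = i ∈ S j

Reach : ∀ {n} → (Fin n → Subset n) → Fin n → Fin n → Set
Reach S = Star (Edge S)

-- Input sets of h: keep only the inputs from the same strongly connected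
-- component (component labelling c : Fin n → Fin t).
restrictS : ∀ {n t} → (Fin n → Subset n) → (Fin n → Fin t) → Fin n → Subset n
restrictS S c j = tabulate (λ i → lookup (S j) i ∧ ⌊ c i Data.Fin.≟ c j ⌋)

module _ {n t : ℕ} (S : Fin n → Subset n) (c : Fin n → Fin t) where

  hNet : Vec Bool n → Vec Bool n
  hNet = network (restrictS S c)

  _⪯_ : Fin t → Fin t → Set
  k ⪯ l = ∃₂ λ i j → c i ≡ k × c j ≡ l × Reach S i j

  _≺_ : Fin t → Fin t → Set
  k ≺ l = k ⪯ l × k ≢ l

  Antichain : Subset t → Set
  Antichain J = ∀ j k → j ∈ J → k ∈ J → j ⪯ k → j ≡ k

  MaxAntichain : Subset t → Set
  MaxAntichain J = Antichain J × (∀ J′ → Antichain J′ → J ⊆ J′ → J′ ≡ J)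

  ZeroOn : Vec Bool n → (Fin t → Set) → Set
  ZeroOn u K = ∀ i → K (c i) → lookup u i ≡ false

  OneOn : Vec Bool n → (Fin t → Set) → Set
  OneOn u K = ∀ i → K (c i) → lookup u i ≡ true

  Admissible : Vec Bool n → Set
  Admissible u = ∀ j →
      (ZeroOn u (λ k → k ≡ j) → ZeroOn u (λ k → j ⪯ k))
    × (OneOn u (λ k → k ≡ j) → OneOn u (λ k → k ⪯ j))

  Regular : Vec Bool n → Set
  Regular u = Σ (Subset t) λ J → MaxAntichain J
    × ZeroOn u (λ k → ∃ λ j → j ∈ J × j ≺ k)
    × OneOn u (λ k → ∃ λ j → j ∈ J × k ≺ j)

nonemptySublists : ∀ {a} {A : Set a} → List A → List (List A)
nonemptySublists [] = []
nonemptySublists (x ∷ xs) =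
  [ x ] ∷ (nonemptySublists xs ++ map (x ∷_) (nonemptySublists xs))

sumℤ : List ℤ → ℤ
sumℤ = foldr _+_ (+ 0)

inclusionExclusion : ∀ {t} → List (Subset t) → ℤ
inclusionExclusion Ω =
  sumℤ (map (λ 𝒥 → ((- (+ 1)) ^ suc (length 𝒥)) * ((+ 2) ^ ∣ ⋂ 𝒥 ∣))
            (nonemptySublists Ω))

module Submission where

-- At a fixed point x of f the value 1 propagates backwards along edges, so x is constant on
-- every component and the components where x = 1 form a down-set of ([t], ⪯); conversely,
-- since every vertex has an input in its own component, each down-set I yields the fixed
-- point that is 1 exactly on the components in I. Down-sets correspond to antichains through
-- their sets of maximal elements, and the antichains are exactly the sets contained in some
-- maximal antichain, so the fixed points are counted by inclusion–exclusion over Ω. For an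
-- admissible fixed point u of h the components where u = 1 again form a down-set I; the
-- maximal elements of I, together with the minimal elements among the components lying
-- neither in I nor above a maximal element of I, form a maximal antichain J with J^≺
-- disjoint from I and J^≻ ⊆ I.

open import Defs hiding (Antichain; MaxAntichain)
open import Data.Bool using (Bool; true; false; _∧_; _∨_; T; if_then_else_)
import Data.Bool
open import Data.Bool.Properties using (∧-identityʳ; ∧-zeroʳ; T-irrelevant; T-≡; ⇔→≡; ¬-not)
open import Data.Bool.ListAction using (any; all)
open import Data.Nat as ℕ using (ℕ; zero; suc)
import Data.Nat.Properties as ℕ
open import Data.Fin using (Fin; _≟_)
open import Data.Fin.Induction using (po-noetherian)
open import Data.Fin.Properties using (any?; all?; +↔⊎; 0↔⊥; 1↔⊤)
open import Data.Fin.Subset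
  using (Subset; Nonempty; _∈_; _∉_; _⊆_; _∩_; _∪_; ⊤; ⁅_⁆; ⋂; ∣_∣; inside; outside)
open import Data.Fin.Subset.Properties
  using ( _∈?_; _⊆?_; ∈⊤; ⊆⊤; ⊆-antisym; p⊂q⇒∣p∣<∣q∣; ∣⊤∣≡n; p⊆p∪q; q⊆p∪q; x∈p∪q⁻
        ; x∈⁅x⁆; x∈⁅y⁆⇒x≡y)
open import Data.Vec using (Vec; []; _∷_; tabulate; lookup; here; there)
open import Data.Vec.Properties
  using (lookup∘tabulate; tabulate∘lookup; tabulate-cong; []=⇒lookup; lookup⇒[]=; ≡-dec)
open import Data.List using (List; []; _∷_; [_]; _++_; map; length)
open import Data.List.Properties using (map-++; map-cong; map-∘)
open import Data.List.Membership.Propositional using (find; lose) renaming (_∈_ to _∈ₗ_)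
open import Data.List.Relation.Unary.Any.Properties using (any⁺; any⁻)
open import Data.List.Relation.Unary.Unique.Propositional using (Unique)
open import Data.Integer using (ℤ; +_; -_; _+_; _-_; _*_; _^_)
import Data.Integer.Properties as ℤ
open import Data.Integer.Tactic.RingSolver using (solve-∀)
open import Data.Product using (Σ; ∃; ∃₂; _×_; _,_; proj₁; proj₂)
open import Data.Product.Properties using (Σ-≡,≡→≡)
open import Data.Sum using (_⊎_; inj₁; inj₂)
open import Data.Sum.Function.Propositional using (_⊎-↔_)
open import Data.Empty using (⊥-elim)
open import Function using (_∘_; flip; id)
open import Function.Bundles using (_↔_; _⇔_; mk↔ₛ′; mk⇔; Equivalence)
open import Function.Construct.Composition using (_↔-∘_)
open import Induction.WellFounded using (Acc; acc)
open import Level using (0ℓ)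
open import Relation.Binary using (Rel; Decidable; IsPartialOrder)
import Relation.Binary.Construct.Flip.EqAndOrd as Flip
import Relation.Binary.Construct.NonStrictToStrict as ToStrict
open import Relation.Binary.Construct.Closure.ReflexiveTransitive as Star
  using (Star; ε; _◅_; _◅◅_)
open import Relation.Binary.PropositionalEquality
  using (_≡_; isEquivalence; refl; sym; trans; cong; cong₂; subst; module ≡-Reasoning)
open import Axiom.UniquenessOfIdentityProofs using (module Decidable⇒UIP)
open import Relation.Nullary using (Dec; yes; no; does; ¬_; ¬?)
open import Relation.Nullary.Decidable
  using (_×-dec_; _⊎-dec_; _→-dec_; fromWitness; dec-true; decidable-stable; map′)
open import Relation.Nullary.Irrelevant using (Irrelevant)
import Relation.Unary as U

Σ-irrelevant-↔ : ∀ {A B : Set} {P : A → Set} {Q : B → Set} →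
  (∀ {a} → Irrelevant (P a)) → (∀ {b} → Irrelevant (Q b)) →
  (f : A → B) (g : B → A) → (∀ {a} → P a → Q (f a)) → (∀ {b} → Q b → P (g b)) →
  (∀ {b} → Q b → f (g b) ≡ b) → (∀ {a} → P a → g (f a) ≡ a) →
  Σ A P ↔ Σ B Q
Σ-irrelevant-↔ P-irrelevant Q-irrelevant f g f⁺ g⁺ f∘g g∘f = mk↔ₛ′
  (λ (a , p) → f a , f⁺ p) (λ (b , q) → g b , g⁺ q)
  (λ (b , q) → Σ-≡,≡→≡ (f∘g q , Q-irrelevant _ _))
  (λ (a , p) → Σ-≡,≡→≡ (g∘f p , P-irrelevant _ _))

does-sound : ∀ {A : Set} (a? : Dec A) → T (does a?) → A
does-sound (yes a) _ = a

does-complete : ∀ {A : Set} (a? : Dec A) → A → T (does a?)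
does-complete a? a = Equivalence.from T-≡ (dec-true a? a)

lookup-ext : ∀ {A : Set} {n} {u v : Vec A n} → (∀ i → lookup u i ≡ lookup v i) → u ≡ v
lookup-ext {u = u} {v} eq =
  trans (sym (tabulate∘lookup u)) (trans (tabulate-cong eq) (tabulate∘lookup v))

module _ {t} {P : Fin t → Set} (P? : U.Decidable P) where

  select : Subset t
  select = tabulate (does ∘ P?)

  select⁺ : ∀ {k} → P k → k ∈ select
  select⁺ {k} p = lookup⇒[]= k select (trans (lookup∘tabulate _ k) (dec-true (P? k) p))

  select⁻ : ∀ {k} → k ∈ select → P k
  select⁻ {k} k∈ =
    does-sound (P? k) (Equivalence.from T-≡ (trans (sym (lookup∘tabulate _ k)) ([]=⇒lookup k∈)))

-- Counting subsets and inclusion–exclusion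

count : ∀ {t} → (Subset t → Bool) → ℕ
count {zero} p = if p [] then 1 else 0
count {suc t} p = count (p ∘ (outside ∷_)) ℕ.+ count (p ∘ (inside ∷_))

Fin-if↔T : ∀ b → Fin (if b then 1 else 0) ↔ T b
Fin-if↔T true = 1↔⊤
Fin-if↔T false = 0↔⊥

Σ-[]↔ : ∀ {A : Set} (P : Vec A 0 → Set) → P [] ↔ Σ (Vec A 0) P
Σ-[]↔ P = mk↔ₛ′ ([] ,_) (λ { ([] , p) → p }) (λ { ([] , p) → refl }) (λ _ → refl)

Σ-∷↔ : ∀ {t} (P : Vec Bool (suc t) → Set) →
  (Σ (Vec Bool t) (P ∘ (false ∷_)) ⊎ Σ (Vec Bool t) (P ∘ (true ∷_))) ↔ Σ (Vec Bool (suc t)) P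
Σ-∷↔ P = mk↔ₛ′ to from to∘from from∘to
  where
  to : Σ _ (P ∘ (false ∷_)) ⊎ Σ _ (P ∘ (true ∷_)) → Σ _ P
  to (inj₁ (y , p)) = false ∷ y , p
  to (inj₂ (y , p)) = true ∷ y , p
  from : Σ _ P → Σ _ (P ∘ (false ∷_)) ⊎ Σ _ (P ∘ (true ∷_))
  from (false ∷ y , p) = inj₁ (y , p)
  from (true ∷ y , p) = inj₂ (y , p)
  to∘from : ∀ z → to (from z) ≡ z
  to∘from (false ∷ y , p) = refl
  to∘from (true ∷ y , p) = refl
  from∘to : ∀ z → from (to z) ≡ z
  from∘to (inj₁ _) = refl
  from∘to (inj₂ _) = refl

Fin-count↔ : ∀ {t} (p : Subset t → Bool) → Fin (count p) ↔ Σ (Subset t) (T ∘ p)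
Fin-count↔ {zero} p = Σ-[]↔ (T ∘ p) ↔-∘ Fin-if↔T (p [])
Fin-count↔ {suc t} p = Σ-∷↔ (T ∘ p) ↔-∘ ((Fin-count↔ _ ⊎-↔ Fin-count↔ _) ↔-∘ +↔⊎)

indicator : Bool → ℤ
indicator b = + (if b then 1 else 0)

indicator-∧ : ∀ a b → indicator (a ∧ b) ≡ indicator a * indicator b
indicator-∧ true b = sym (ℤ.*-identityˡ (indicator b))
indicator-∧ false b = refl

indicator-∨ : ∀ a b → indicator (a ∨ b) ≡ indicator a + indicator b - indicator a * indicator b
indicator-∨ true true = refl
indicator-∨ true false = refl
indicator-∨ false true = refl
indicator-∨ false false = refl

sumℤ-++ : ∀ xs ys → sumℤ (xs ++ ys) ≡ sumℤ xs + sumℤ ys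
sumℤ-++ [] ys = sym (ℤ.+-identityˡ _)
sumℤ-++ (x ∷ xs) ys = trans (cong (_+_ x) (sumℤ-++ xs ys)) (sym (ℤ.+-assoc x _ _))

sumℤ-*ˡ : ∀ {A : Set} k (g : A → ℤ) xs → sumℤ (map (λ a → k * g a) xs) ≡ k * sumℤ (map g xs)
sumℤ-*ˡ k g [] = sym (ℤ.*-zeroʳ k)
sumℤ-*ˡ k g (x ∷ xs) =
  trans (cong (_+_ (k * g x)) (sumℤ-*ˡ k g xs)) (sym (ℤ.*-distribˡ-+ k _ _))

sign : ∀ {A : Set} → List A → ℤ
sign 𝒥 = (- (+ 1)) ^ suc (length 𝒥)

indicator-any : ∀ {A : Set} (p : A → Bool) xs →
  indicator (any p xs) ≡ sumℤ (map (λ 𝒥 → sign 𝒥 * indicator (all p 𝒥)) (nonemptySublists xs))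
indicator-any p [] = refl
indicator-any p (x ∷ xs) = sym (begin
    sumℤ (map term (nonemptySublists (x ∷ xs)))
  ≡⟨ cong (λ s → term [ x ] + sumℤ s) (map-++ term ns (map (x ∷_) ns)) ⟩
    term [ x ] + sumℤ (map term ns ++ map term (map (x ∷_) ns))
  ≡⟨ cong (_+_ (term [ x ])) (sumℤ-++ (map term ns) _) ⟩
    term [ x ] + (sumℤ (map term ns) + sumℤ (map term (map (x ∷_) ns)))
  ≡⟨ cong₂ (λ u v → u + (sumℤ (map term ns) + v)) term-[x] terms-x∷ ⟩
    a + (sumℤ (map term ns) + - a * sumℤ (map term ns))
  ≡⟨ cong (λ s → a + (s + - a * s)) (sym (indicator-any p xs)) ⟩
    a + (b + - a * b)
  ≡⟨ rearrange a b ⟩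
    a + b - a * b
  ≡⟨ sym (indicator-∨ (p x) (any p xs)) ⟩
    indicator (any p (x ∷ xs))
  ∎)
  where
  open ≡-Reasoning
  term : List _ → ℤ
  term 𝒥 = sign 𝒥 * indicator (all p 𝒥)
  ns = nonemptySublists xs
  a = indicator (p x)
  b = indicator (any p xs)
  rearrange : ∀ u v → u + (v + - u * v) ≡ u + v - u * v
  rearrange = solve-∀
  term-[x] : term [ x ] ≡ a
  term-[x] = trans (ℤ.*-identityˡ _) (cong indicator (∧-identityʳ (p x)))
  term-x∷ : ∀ 𝒥 → term (x ∷ 𝒥) ≡ - a * term 𝒥
  term-x∷ 𝒥 = trans (cong (sign (x ∷ 𝒥) *_) (indicator-∧ (p x) (all p 𝒥))) (swap (sign 𝒥) a _)
    where
    swap : ∀ s u v → (- (+ 1) * s) * (u * v) ≡ - u * (s * v)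
    swap = solve-∀
  terms-x∷ : sumℤ (map term (map (x ∷_) ns)) ≡ - a * sumℤ (map term ns)
  terms-x∷ = trans (cong sumℤ (trans (sym (map-∘ ns)) (map-cong term-x∷ ns)))
                   (sumℤ-*ˡ (- a) term ns)

sumSubsets : ∀ {t} → (Subset t → ℤ) → ℤ
sumSubsets {zero} g = g []
sumSubsets {suc t} g = sumSubsets (g ∘ (outside ∷_)) + sumSubsets (g ∘ (inside ∷_))

count≡sumSubsets : ∀ {t} (p : Subset t → Bool) → + count p ≡ sumSubsets (indicator ∘ p)
count≡sumSubsets {zero} p = refl
count≡sumSubsets {suc t} p = trans (ℤ.pos-+ (count {t} _) (count {t} _))
  (cong₂ _+_ (count≡sumSubsets {t} _) (count≡sumSubsets {t} _))

sumSubsets-cong : ∀ {t} {f g : Subset t → ℤ} → (∀ y → f y ≡ g y) → sumSubsets f ≡ sumSubsets g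
sumSubsets-cong {zero} eq = eq []
sumSubsets-cong {suc t} eq =
  cong₂ _+_ (sumSubsets-cong (eq ∘ (outside ∷_))) (sumSubsets-cong (eq ∘ (inside ∷_)))

sumSubsets-0 : ∀ {t} → sumSubsets {t} (λ _ → + 0) ≡ + 0
sumSubsets-0 {zero} = refl
sumSubsets-0 {suc t} = cong₂ _+_ (sumSubsets-0 {t}) (sumSubsets-0 {t})

sumSubsets-+ : ∀ {t} (f g : Subset t → ℤ) →
  sumSubsets (λ y → f y + g y) ≡ sumSubsets f + sumSubsets g
sumSubsets-+ {zero} f g = refl
sumSubsets-+ {suc t} f g = trans
  (cong₂ _+_ (sumSubsets-+ (f ∘ (outside ∷_)) (g ∘ (outside ∷_)))
             (sumSubsets-+ (f ∘ (inside ∷_)) (g ∘ (inside ∷_))))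
  (interchange (sumSubsets {t} _) (sumSubsets {t} _) (sumSubsets {t} _) (sumSubsets {t} _))
  where
  interchange : ∀ a b c d → (a + b) + (c + d) ≡ (a + c) + (b + d)
  interchange = solve-∀

sumSubsets-*ˡ : ∀ {t} k (f : Subset t → ℤ) → sumSubsets (λ y → k * f y) ≡ k * sumSubsets f
sumSubsets-*ˡ {zero} k f = refl
sumSubsets-*ˡ {suc t} k f =
  trans (cong₂ _+_ (sumSubsets-*ˡ {t} k _) (sumSubsets-*ˡ {t} k _)) (sym (ℤ.*-distribˡ-+ k _ _))

sumSubsets-sumℤ : ∀ {t} {A : Set} (F : A → Subset t → ℤ) xs →
  sumSubsets (λ y → sumℤ (map (λ a → F a y) xs)) ≡ sumℤ (map (λ a → sumSubsets (F a)) xs)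
sumSubsets-sumℤ {t} F [] = sumSubsets-0 {t}
sumSubsets-sumℤ F (x ∷ xs) =
  trans (sumSubsets-+ (F x) _) (cong (_+_ (sumSubsets (F x))) (sumSubsets-sumℤ F xs))

sumSubsets-⊆ : ∀ {t} (q : Subset t) →
  sumSubsets (λ y → indicator (does (y ⊆? q))) ≡ (+ 2) ^ ∣ q ∣
sumSubsets-⊆ [] = refl
sumSubsets-⊆ (inside ∷ q) = trans (cong₂ _+_ (sumSubsets-⊆ q) (sumSubsets-⊆ q)) (double _)
  where
  double : ∀ a → a + a ≡ + 2 * a
  double = solve-∀
sumSubsets-⊆ {suc t} (outside ∷ q) =
  trans (cong₂ _+_ (sumSubsets-⊆ q) (sumSubsets-0 {t})) (ℤ.+-identityʳ _)

⊆?-∩ : ∀ {t} (y p q : Subset t) → does (y ⊆? p ∩ q) ≡ does (y ⊆? p) ∧ does (y ⊆? q)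
⊆?-∩ [] [] [] = refl
⊆?-∩ (outside ∷ y) (_ ∷ p) (_ ∷ q) = ⊆?-∩ y p q
⊆?-∩ (inside ∷ y) (inside ∷ p) (inside ∷ q) = ⊆?-∩ y p q
⊆?-∩ (inside ∷ y) (inside ∷ p) (outside ∷ q) = sym (∧-zeroʳ _)
⊆?-∩ (inside ∷ y) (outside ∷ p) (_ ∷ q) = refl

all-⊆?-⋂ : ∀ {t} (y : Subset t) 𝒥 → all (λ J → does (y ⊆? J)) 𝒥 ≡ does (y ⊆? ⋂ 𝒥)
all-⊆?-⋂ y [] = sym (dec-true (y ⊆? ⊤) ⊆⊤)
all-⊆?-⋂ y (J ∷ 𝒥) =
  trans (cong (does (y ⊆? J) ∧_) (all-⊆?-⋂ y 𝒥)) (sym (⊆?-∩ y J (⋂ 𝒥)))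

covered : ∀ {t} → List (Subset t) → Subset t → Bool
covered Ω y = any (λ J → does (y ⊆? J)) Ω

count-covered : ∀ {t} (Ω : List (Subset t)) → + count (covered Ω) ≡ inclusionExclusion Ω
count-covered {t} Ω = begin
    + count (covered Ω)
  ≡⟨ count≡sumSubsets (covered Ω) ⟩
    sumSubsets (λ y → indicator (covered Ω y))
  ≡⟨ sumSubsets-cong (λ y → indicator-any (λ J → does (y ⊆? J)) Ω) ⟩
    sumSubsets (λ y → sumℤ (map (λ 𝒥 → term 𝒥 y) (nonemptySublists Ω)))
  ≡⟨ sumSubsets-sumℤ term (nonemptySublists Ω) ⟩
    sumℤ (map (λ 𝒥 → sumSubsets (term 𝒥)) (nonemptySublists Ω))
  ≡⟨ cong sumℤ (map-cong sum-term (nonemptySublists Ω)) ⟩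
    inclusionExclusion Ω
  ∎
  where
  open ≡-Reasoning
  term : List (Subset t) → Subset t → ℤ
  term 𝒥 y = sign 𝒥 * indicator (all (λ J → does (y ⊆? J)) 𝒥)
  sum-term : ∀ 𝒥 → sumSubsets (term 𝒥) ≡ sign 𝒥 * (+ 2) ^ ∣ ⋂ 𝒥 ∣
  sum-term 𝒥 = trans (sumSubsets-*ˡ {t} (sign 𝒥) _) (cong (sign 𝒥 *_)
    (trans (sumSubsets-cong (λ y → cong indicator (all-⊆?-⋂ y 𝒥))) (sumSubsets-⊆ (⋂ 𝒥))))

-- Finite posets

module Maximality {t} {_≤_ : Rel (Fin t) 0ℓ}
  (isPartialOrder : IsPartialOrder _≡_ _≤_) (_≤?_ : Decidable _≤_) where

  open IsPartialOrder isPartialOrder using () renaming (refl to ≤-refl; trans to ≤-trans)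
  open ToStrict _≡_ _≤_ using (_<_)

  Maximal : (Fin t → Set) → Fin t → Set
  Maximal P m = P m × (∀ z → P z → m ≤ z → m ≡ z)

  Maximal? : ∀ {P} → U.Decidable P → U.Decidable (Maximal P)
  Maximal? P? m = P? m ×-dec all? (λ z → P? z →-dec ((m ≤? z) →-dec (m ≟ z)))

  maximal-above : ∀ {P} → U.Decidable P → ∀ {x} → P x → ∃ λ m → Maximal P m × x ≤ m
  maximal-above {P} P? {x} = go (po-noetherian isPartialOrder x)
    where
    go : ∀ {x} → Acc (flip _<_) x → P x → ∃ λ m → Maximal P m × x ≤ m
    go {x} (acc rec) px with any? (λ z → P? z ×-dec ((x ≤? z) ×-dec ¬? (x ≟ z)))
    ... | yes (z , pz , x<z) =
      let m , m-max , z≤m = go (rec x<z) pz in m , m-max , ≤-trans (proj₁ x<z) z≤m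
    ... | no ∄ =
      x , (px , λ z pz x≤z → decidable-stable (x ≟ z) λ x≢z → ∄ (z , pz , x≤z , x≢z)) , ≤-refl

module FinitePoset {t} {_≤_ : Rel (Fin t) 0ℓ}
  (isPartialOrder : IsPartialOrder _≡_ _≤_) (_≤?_ : Decidable _≤_) where

  open IsPartialOrder isPartialOrder using (antisym) renaming (refl to ≤-refl; trans to ≤-trans)
  open ToStrict _≡_ _≤_ using (_<_)
  open Maximality isPartialOrder _≤?_ public
  open Maximality (Flip.isPartialOrder isPartialOrder) (flip _≤?_) public
    renaming (Maximal to Minimal; Maximal? to Minimal?; maximal-above to minimal-below)

  _<?_ : Decidable _<_
  _<?_ = ToStrict.<-decidable _≡_ _≤_ _≟_ _≤?_

  <-≤-trans : ∀ {a b c} → a < b → b ≤ c → a < c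
  <-≤-trans = ToStrict.<-≤-trans _≡_ _≤_ sym ≤-trans antisym (λ { refl b≤c → b≤c })

  Antichain : Subset t → Set
  Antichain J = ∀ j k → j ∈ J → k ∈ J → j ≤ k → j ≡ k

  MaxAntichain : Subset t → Set
  MaxAntichain J = Antichain J × (∀ J′ → Antichain J′ → J ⊆ J′ → J′ ≡ J)

  DownClosed : Subset t → Set
  DownClosed I = ∀ k l → k ≤ l → l ∈ I → k ∈ I

  DownClosed? : U.Decidable DownClosed
  DownClosed? I = all? λ k → all? λ l → (k ≤? l) →-dec ((l ∈? I) →-dec (k ∈? I))

  -- A Boolean, so that Σ-types over it have proof-irrelevant second components.
  isDownClosed : Subset t → Bool
  isDownClosed I = does (DownClosed? I)

  maxElements : Subset t → Subset t
  maxElements I = select (Maximal? (_∈? I))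

  Below : Subset t → Fin t → Set
  Below A k = ∃ λ a → a ∈ A × k ≤ a

  Below? : ∀ A → U.Decidable (Below A)
  Below? A k = any? λ a → (a ∈? A) ×-dec (k ≤? a)

  downClosure : Subset t → Subset t
  downClosure A = select (Below? A)

  ⊆-downClosure : ∀ {A} → A ⊆ downClosure A
  ⊆-downClosure {A} {a} a∈A = select⁺ (Below? A) (a , a∈A , ≤-refl)

  downClosure-downClosed : ∀ A → DownClosed (downClosure A)
  downClosure-downClosed A k l k≤l l∈ =
    let a , a∈A , l≤a = select⁻ (Below? A) l∈ in select⁺ (Below? A) (a , a∈A , ≤-trans k≤l l≤a)

  maxElements-downClosure : ∀ {A} → Antichain A → maxElements (downClosure A) ≡ A
  maxElements-downClosure {A} A-antichain = ⊆-antisym max⊆A A⊆max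
    where
    max⊆A : maxElements (downClosure A) ⊆ A
    max⊆A {k} k∈ =
      let k∈↓A , k-max = select⁻ (Maximal? (_∈? downClosure A)) k∈
          a , a∈A , k≤a = select⁻ (Below? A) k∈↓A
      in subst (_∈ A) (sym (k-max a (⊆-downClosure a∈A) k≤a)) a∈A
    maximal : ∀ {a} → a ∈ A → ∀ z → z ∈ downClosure A → a ≤ z → a ≡ z
    maximal {a} a∈A z z∈ a≤z =
      let a′ , a′∈A , z≤a′ = select⁻ (Below? A) z∈
          a≡a′ = A-antichain a a′ a∈A a′∈A (≤-trans a≤z z≤a′)
      in antisym a≤z (subst (z ≤_) (sym a≡a′) z≤a′)
    A⊆max : A ⊆ maxElements (downClosure A)
    A⊆max a∈A = select⁺ (Maximal? (_∈? downClosure A)) (⊆-downClosure a∈A , maximal a∈A)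

  downClosure-maxElements : ∀ {I} → DownClosed I → downClosure (maxElements I) ≡ I
  downClosure-maxElements {I} I-downClosed = ⊆-antisym ↓max⊆I I⊆↓max
    where
    ↓max⊆I : downClosure (maxElements I) ⊆ I
    ↓max⊆I {k} k∈ =
      let m , m∈ , k≤m = select⁻ (Below? (maxElements I)) k∈
      in I-downClosed k m k≤m (proj₁ (select⁻ (Maximal? (_∈? I)) m∈))
    I⊆↓max : I ⊆ downClosure (maxElements I)
    I⊆↓max k∈I =
      let m , m-max , k≤m = maximal-above (_∈? I) k∈I
      in select⁺ (Below? (maxElements I)) (m , select⁺ (Maximal? (_∈? I)) m-max , k≤m)

  comparable⇒maxAntichain : ∀ {J} → Antichain J →
    (∀ k → ∃ λ j → j ∈ J × (k ≤ j ⊎ j ≤ k)) → MaxAntichain J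
  comparable⇒maxAntichain {J} J-antichain comparable = J-antichain , maximal
    where
    maximal : ∀ J′ → Antichain J′ → J ⊆ J′ → J′ ≡ J
    maximal J′ J′-antichain J⊆J′ = ⊆-antisym J′⊆J J⊆J′
      where
      J′⊆J : J′ ⊆ J
      J′⊆J {k} k∈J′ with comparable k
      ... | j , j∈J , inj₁ k≤j = subst (_∈ J) (sym (J′-antichain k j k∈J′ (J⊆J′ j∈J) k≤j)) j∈J
      ... | j , j∈J , inj₂ j≤k = subst (_∈ J) (J′-antichain j k (J⊆J′ j∈J) k∈J′ j≤k) j∈J

  module Completion (I : Subset t) (I-downClosed : DownClosed I) where

    Free : Fin t → Set
    Free k = k ∉ I × ¬ (∃ λ m → Maximal (_∈ I) m × m < k)

    Free? : U.Decidable Free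
    Free? k = ¬? (k ∈? I) ×-dec ¬? (any? λ m → Maximal? (_∈? I) m ×-dec (m <? k))

    Member? : U.Decidable (λ k → Maximal (_∈ I) k ⊎ Minimal Free k)
    Member? k = Maximal? (_∈? I) k ⊎-dec Minimal? Free? k

    completion : Subset t
    completion = select Member?

    maxElements⊆completion : maxElements I ⊆ completion
    maxElements⊆completion k∈ = select⁺ Member? (inj₁ (select⁻ (Maximal? (_∈? I)) k∈))

    completion-antichain : Antichain completion
    completion-antichain j k j∈ k∈ j≤k with select⁻ Member? j∈ | select⁻ Member? k∈
    ... | inj₁ (_ , j-max) | inj₁ (k∈I , _) = j-max k k∈I j≤k
    ... | inj₂ (j-free , _) | inj₂ (_ , k-min) = sym (k-min j j-free j≤k)
    ... | inj₁ j-max | inj₂ ((_ , none-below) , _) =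
      decidable-stable (j ≟ k) λ j≢k → none-below (j , j-max , j≤k , j≢k)
    ... | inj₂ ((j∉I , _) , _) | inj₁ (k∈I , _) = ⊥-elim (j∉I (I-downClosed j k j≤k k∈I))

    completion-comparable : ∀ k → ∃ λ j → j ∈ completion × (k ≤ j ⊎ j ≤ k)
    completion-comparable k with k ∈? I
    ... | yes k∈I = let m , m-max , k≤m = maximal-above (_∈? I) k∈I
                    in m , select⁺ Member? (inj₁ m-max) , inj₁ k≤m
    ... | no k∉I with any? (λ m → Maximal? (_∈? I) m ×-dec (m <? k))
    ...   | yes (m , m-max , m<k) = m , select⁺ Member? (inj₁ m-max) , inj₂ (proj₁ m<k)
    ...   | no ∄ = let m , m-min , m≤k = minimal-below Free? (k∉I , ∄)
                   in m , select⁺ Member? (inj₂ m-min) , inj₂ m≤k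

    completion-maxAntichain : MaxAntichain completion
    completion-maxAntichain =
      comparable⇒maxAntichain completion-antichain completion-comparable

    completion-above : ∀ {j k} → j ∈ completion → j < k → k ∉ I
    completion-above j∈ (j≤k , j≢k) k∈I with select⁻ Member? j∈
    ... | inj₁ (_ , j-max) = j≢k (j-max _ k∈I j≤k)
    ... | inj₂ ((j∉I , _) , _) = j∉I (I-downClosed _ _ j≤k k∈I)

    completion-below : ∀ {j k} → j ∈ completion → k < j → k ∈ I
    completion-below {j} {k} j∈ (k≤j , k≢j) with select⁻ Member? j∈
    ... | inj₁ (j∈I , _) = I-downClosed k j k≤j j∈I
    ... | inj₂ ((_ , none-below-j) , j-min) = decidable-stable (k ∈? I) λ k∉I →
      let k-free = k∉I , λ (m , m-max , m<k) → none-below-j (m , m-max , <-≤-trans m<k k≤j)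
      in k≢j (sym (j-min k k-free k≤j))

  module _ (Ω : List (Subset t)) (Ω-maxAntichains : ∀ J → (J ∈ₗ Ω) ⇔ MaxAntichain J) where

    covered⇒antichain : ∀ {A} → T (covered Ω A) → Antichain A
    covered⇒antichain {A} A-covered j k j∈A k∈A j≤k =
      let J , J∈Ω , A⊆J = find (any⁻ (λ J → does (A ⊆? J)) Ω A-covered)
          J-antichain , _ = Equivalence.to (Ω-maxAntichains J) J∈Ω
      in J-antichain j k (does-sound (A ⊆? J) A⊆J j∈A) (does-sound (A ⊆? J) A⊆J k∈A) j≤k

    downClosed⇒covered : ∀ {I} → DownClosed I → T (covered Ω (maxElements I))
    downClosed⇒covered {I} I-downClosed =
      any⁺ _ (lose J∈Ω (does-complete (_ ⊆? completion) maxElements⊆completion))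
      where
      open Completion I I-downClosed
      J∈Ω : completion ∈ₗ Ω
      J∈Ω = Equivalence.from (Ω-maxAntichains completion) completion-maxAntichain

    covered↔downClosed : Σ (Subset t) (T ∘ covered Ω) ↔ Σ (Subset t) (T ∘ isDownClosed)
    covered↔downClosed = Σ-irrelevant-↔ T-irrelevant T-irrelevant downClosure maxElements
      (λ {A} _ → does-complete (DownClosed? (downClosure A)) (downClosure-downClosed A))
      (λ {I} h → downClosed⇒covered (does-sound (DownClosed? I) h))
      (λ {I} h → downClosure-maxElements (does-sound (DownClosed? I) h))
      (λ h → maxElements-downClosure (covered⇒antichain h))

-- Reachability in a finite graph

module _ {n} {E : Rel (Fin n) 0ℓ} (E? : Decidable E) where

  private
    Closed : Subset n → Set
    Closed R = ∀ {a b} → a ∈ R → E a b → b ∈ R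

    Exit : Subset n → Set
    Exit R = ∃₂ λ a b → a ∈ R × E a b × b ∉ R

    exit? : U.Decidable Exit
    exit? R = any? λ a → any? λ b → (a ∈? R) ×-dec (E? a b ×-dec ¬? (b ∈? R))

    ReachableFrom : Fin n → Subset n → Set
    ReachableFrom i R = ∀ {j} → j ∈ R → Star E i j

    closed-star : ∀ {R a b} → Closed R → a ∈ R → Star E a b → b ∈ R
    closed-star R-closed a∈R ε = a∈R
    closed-star R-closed a∈R (e ◅ p) = closed-star R-closed (R-closed a∈R e) p

    x∉p⇒∣p∣<n : ∀ {R : Subset n} {b} → b ∉ R → ∣ R ∣ ℕ.< n
    x∉p⇒∣p∣<n {R} b∉R = subst (∣ R ∣ ℕ.<_) (∣⊤∣≡n n) (p⊂q⇒∣p∣<∣q∣ (⊆⊤ , _ , ∈⊤ , b∉R))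

    x∉p⇒∣p∣<∣p∪⁅x⁆∣ : ∀ {R : Subset n} {b} → b ∉ R → ∣ R ∣ ℕ.< ∣ R ∪ ⁅ b ⁆ ∣
    x∉p⇒∣p∣<∣p∪⁅x⁆∣ {R} {b} b∉R =
      p⊂q⇒∣p∣<∣q∣ (p⊆p∪q ⁅ b ⁆ , b , q⊆p∪q R ⁅ b ⁆ (x∈⁅x⁆ b) , b∉R)

    -- Each round adds the target of an edge leaving R, so after n rounds R is closed.
    close : ∀ {i} fuel R → n ℕ.≤ fuel ℕ.+ ∣ R ∣ → ReachableFrom i R → i ∈ R →
      ∃ λ R* → Closed R* × ReachableFrom i R* × i ∈ R*
    close fuel R bound R-reachable i∈R with exit? R
    ... | no no-exit = R , R-closed , R-reachable , i∈R
      where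
      R-closed : Closed R
      R-closed {a} {b} a∈R e =
        decidable-stable (b ∈? R) λ b∉R → no-exit (a , b , a∈R , e , b∉R)
    close zero R bound _ _ | yes (_ , _ , _ , _ , b∉R) =
      ⊥-elim (ℕ.<⇒≱ (x∉p⇒∣p∣<n b∉R) bound)
    close {i} (suc fuel) R bound R-reachable i∈R | yes (a , b , a∈R , e , b∉R) =
      close fuel (R ∪ ⁅ b ⁆) bound′ reachable′ (p⊆p∪q ⁅ b ⁆ i∈R)
      where
      bound′ : n ℕ.≤ fuel ℕ.+ ∣ R ∪ ⁅ b ⁆ ∣
      bound′ = ℕ.≤-trans bound (ℕ.≤-trans (ℕ.≤-reflexive (sym (ℕ.+-suc fuel ∣ R ∣)))
                                          (ℕ.+-monoʳ-≤ fuel (x∉p⇒∣p∣<∣p∪⁅x⁆∣ b∉R)))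
      reachable′ : ReachableFrom i (R ∪ ⁅ b ⁆)
      reachable′ {j} j∈ with x∈p∪q⁻ R ⁅ b ⁆ j∈
      ... | inj₁ j∈R = R-reachable j∈R
      ... | inj₂ j∈⁅b⁆ =
        subst (Star E i) (sym (x∈⁅y⁆⇒x≡y b j∈⁅b⁆)) (R-reachable a∈R ◅◅ (e ◅ ε))

  Star? : Decidable (Star E)
  Star? i j =
    let R , R-closed , R-reachable , i∈R = close n ⁅ i ⁆ (ℕ.m≤m+n n _) i⇝⁅i⁆ (x∈⁅x⁆ i)
    in map′ R-reachable (closed-star R-closed i∈R) (j ∈? R)
    where
    i⇝⁅i⁆ : ReachableFrom i ⁅ i ⁆
    i⇝⁅i⁆ j∈ = subst (Star E i) (sym (x∈⁅y⁆⇒x≡y i j∈)) ε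

-- Fixed points of conjunctive networks

conjOver≡true⁻ : ∀ {n} (s x : Vec Bool n) → conjOver s x ≡ true →
  ∀ {i} → i ∈ s → lookup x i ≡ true
conjOver≡true⁻ (inside ∷ s) (false ∷ x) () _
conjOver≡true⁻ (inside ∷ s) (true ∷ x) _ here = refl
conjOver≡true⁻ (inside ∷ s) (true ∷ x) e (there i∈s) = conjOver≡true⁻ s x e i∈s
conjOver≡true⁻ (outside ∷ s) (_ ∷ x) e (there i∈s) = conjOver≡true⁻ s x e i∈s

conjOver≡true⁺ : ∀ {n} (s x : Vec Bool n) →
  (∀ {i} → i ∈ s → lookup x i ≡ true) → conjOver s x ≡ true
conjOver≡true⁺ [] [] _ = refl
conjOver≡true⁺ (inside ∷ s) (v ∷ x) all-true rewrite all-true here =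
  conjOver≡true⁺ s x (all-true ∘ there)
conjOver≡true⁺ (outside ∷ s) (_ ∷ x) all-true = conjOver≡true⁺ s x (all-true ∘ there)

module _ {n} (S : Fin n → Subset n) {x : Vec Bool n} (x-fixed : network S x ≡ x) where

  fixed-lookup : ∀ j → lookup x j ≡ conjOver (S j) x
  fixed-lookup j = trans (cong (λ v → lookup v j) (sym x-fixed)) (lookup∘tabulate _ j)

  fixed-true-backward : ∀ {a b} → Reach S a b → lookup x b ≡ true → lookup x a ≡ true
  fixed-true-backward = Star.fold (λ a b → lookup x b ≡ true → lookup x a ≡ true)
    (λ a∈Sb xb⇒xc xc → conjOver≡true⁻ _ x (trans (sym (fixed-lookup _)) (xb⇒xc xc)) a∈Sb) id

  fixed-constant-on-cycles : ∀ {a b} → Reach S a b → Reach S b a → lookup x a ≡ lookup x b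
  fixed-constant-on-cycles a⇝b b⇝a =
    ⇔→≡ (mk⇔ (fixed-true-backward b⇝a) (fixed-true-backward a⇝b))

-- The condensation of the dependency graph

module Condensation {n t} (S : Fin n → Subset n) (c : Fin n → Fin t)
  (c-surjective : ∀ k → ∃ λ i → c i ≡ k)
  (c-components : ∀ i j → (c i ≡ c j) ⇔ (Reach S i j × Reach S j i))
  (component-edge : ∀ k → ∃₂ λ i j → c i ≡ k × c j ≡ k × Edge S i j) where

  rep : Fin t → Fin n
  rep k = proj₁ (c-surjective k)

  c-rep : ∀ k → c (rep k) ≡ k
  c-rep k = proj₂ (c-surjective k)

  same-component⇒reach : ∀ {a b} → c a ≡ c b → Reach S a b
  same-component⇒reach {a} {b} ca≡cb = proj₁ (Equivalence.to (c-components a b) ca≡cb)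

  mutual-reach⇒same-component : ∀ {a b} → Reach S a b → Reach S b a → c a ≡ c b
  mutual-reach⇒same-component {a} {b} a⇝b b⇝a =
    Equivalence.from (c-components a b) (a⇝b , b⇝a)

  ⪯⇒reach-rep : ∀ {k l} → _⪯_ S c k l → Reach S (rep k) (rep l)
  ⪯⇒reach-rep {k} {l} (i , j , ci≡k , cj≡l , i⇝j) =
    same-component⇒reach (trans (c-rep k) (sym ci≡k)) ◅◅ i⇝j ◅◅
    same-component⇒reach (trans cj≡l (sym (c-rep l)))

  reach-rep⇒⪯ : ∀ {k l} → Reach S (rep k) (rep l) → _⪯_ S c k l
  reach-rep⇒⪯ {k} {l} p = rep k , rep l , c-rep k , c-rep l , p

  _⪯?_ : Decidable (_⪯_ S c)
  k ⪯? l = map′ reach-rep⇒⪯ ⪯⇒reach-rep (Star? (λ i j → i ∈? S j) (rep k) (rep l))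

  ⪯-isPartialOrder : IsPartialOrder _≡_ (_⪯_ S c)
  ⪯-isPartialOrder = record
    { isPreorder = record
      { isEquivalence = isEquivalence
      ; reflexive = λ { refl → reach-rep⇒⪯ ε }
      ; trans = λ k⪯l l⪯m → reach-rep⇒⪯ (⪯⇒reach-rep k⪯l ◅◅ ⪯⇒reach-rep l⪯m)
      }
    ; antisym = λ {k} {l} k⪯l l⪯k → trans (sym (c-rep k))
        (trans (mutual-reach⇒same-component (⪯⇒reach-rep k⪯l) (⪯⇒reach-rep l⪯k)) (c-rep l))
    }

  open FinitePoset ⪯-isPartialOrder _⪯?_ public

  input-on-cycle : ∀ {a b j} → a ∈ S b → Reach S b j → Reach S j a →
    ∃ λ i → i ∈ S j × c i ≡ c j
  input-on-cycle {a} a∈Sb ε j⇝a = a , a∈Sb , mutual-reach⇒same-component (a∈Sb ◅ ε) j⇝a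
  input-on-cycle a∈Sb (e ◅ p) j⇝a = input-on-cycle e p (j⇝a ◅◅ (a∈Sb ◅ ε))

  input-in-component : ∀ j → ∃ λ i → i ∈ S j × c i ≡ c j
  input-in-component j =
    let a , b , ca≡cj , cb≡cj , a∈Sb = component-edge (c j)
    in input-on-cycle a∈Sb (same-component⇒reach cb≡cj) (same-component⇒reach (sym ca≡cj))

  edge-within-component : ∀ {a b} → a ∈ S b → c a ≡ c b → a ∈ restrictS S c b
  edge-within-component {a} a∈Sb ca≡cb = lookup⇒[]= a _ (trans (lookup∘tabulate _ a)
    (cong₂ _∧_ ([]=⇒lookup a∈Sb) (Equivalence.to T-≡ (fromWitness ca≡cb))))

  path-within-component : ∀ {a b} → c a ≡ c b → Reach S a b → Reach (restrictS S c) a b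
  path-within-component ca≡cb ε = ε
  path-within-component ca≡cb (a∈Sa′ ◅ a′⇝b) =
    edge-within-component a∈Sa′ ca≡ca′ ◅ path-within-component (trans (sym ca≡ca′) ca≡cb) a′⇝b
    where
    ca≡ca′ = mutual-reach⇒same-component (a∈Sa′ ◅ ε) (a′⇝b ◅◅ same-component⇒reach (sym ca≡cb))

  ConstantOnComponents : Vec Bool n → Set
  ConstantOnComponents x = ∀ {a b} → c a ≡ c b → lookup x a ≡ lookup x b

  expand : Subset t → Vec Bool n
  expand y = tabulate (lookup y ∘ c)

  contract : Vec Bool n → Subset t
  contract x = tabulate (lookup x ∘ rep)

  lookup-contract : ∀ x → ConstantOnComponents x → ∀ i → lookup (contract x) (c i) ≡ lookup x i
  lookup-contract x x-constant i = trans (lookup∘tabulate _ (c i)) (x-constant (c-rep (c i)))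

  expand-contract : ∀ x → ConstantOnComponents x → expand (contract x) ≡ x
  expand-contract x x-constant =
    lookup-ext λ i → trans (lookup∘tabulate _ i) (lookup-contract x x-constant i)

  contract-expand : ∀ y → contract (expand y) ≡ y
  contract-expand y = lookup-ext λ k →
    trans (lookup∘tabulate _ k) (trans (lookup∘tabulate _ (rep k)) (cong (lookup y) (c-rep k)))

  expand-fixed : ∀ {y} → DownClosed y → network S (expand y) ≡ expand y
  expand-fixed {y} y-downClosed = lookup-ext λ j → trans (lookup∘tabulate _ j)
    (trans (⇔→≡ (mk⇔ (conj⇒y j) (y⇒conj j))) (sym (lookup∘tabulate _ j)))
    where
    conj⇒y : ∀ j → conjOver (S j) (expand y) ≡ true → lookup y (c j) ≡ true
    conj⇒y j conj =
      let i , i∈Sj , ci≡cj = input-in-component j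
      in trans (cong (lookup y) (sym ci≡cj))
               (trans (sym (lookup∘tabulate _ i)) (conjOver≡true⁻ (S j) (expand y) conj i∈Sj))
    y⇒conj : ∀ j → lookup y (c j) ≡ true → conjOver (S j) (expand y) ≡ true
    y⇒conj j yj = conjOver≡true⁺ (S j) (expand y) λ {i} i∈Sj → trans (lookup∘tabulate _ i)
      ([]=⇒lookup (y-downClosed (c i) (c j) (i , j , refl , refl , i∈Sj ◅ ε) (lookup⇒[]= _ y yj)))

  module _ {x} (x-fixed : network S x ≡ x) where

    fixed-constant : ConstantOnComponents x
    fixed-constant ca≡cb = fixed-constant-on-cycles S x-fixed
      (same-component⇒reach ca≡cb) (same-component⇒reach (sym ca≡cb))

    contract-downClosed : DownClosed (contract x)
    contract-downClosed k l k⪯l l∈ = lookup⇒[]= k _ (trans (lookup∘tabulate _ k)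
      (fixed-true-backward S x-fixed (⪯⇒reach-rep k⪯l)
        (trans (sym (lookup∘tabulate _ l)) ([]=⇒lookup l∈))))

  downClosed↔fixed : Σ (Subset t) (T ∘ isDownClosed) ↔ Σ (Vec Bool n) (λ x → network S x ≡ x)
  downClosed↔fixed = Σ-irrelevant-↔ T-irrelevant fixed-irrelevant expand contract
    (λ {y} y-downClosed → expand-fixed (does-sound (DownClosed? y) y-downClosed))
    (λ x-fixed → does-complete (DownClosed? _) (contract-downClosed x-fixed))
    (λ {x} x-fixed → expand-contract x (fixed-constant x-fixed))
    (λ _ → contract-expand _)
    where
    fixed-irrelevant : ∀ {x} → Irrelevant (network S x ≡ x)
    fixed-irrelevant = Decidable⇒UIP.≡-irrelevant (≡-dec Data.Bool._≟_)

  admissible⇒regular : ∀ u → hNet S c u ≡ u → Admissible S c u → Regular S c u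
  admissible⇒regular u u-fixed u-admissible =
    completion , completion-maxAntichain , zero-above , one-below
    where
    u-constant : ConstantOnComponents u
    u-constant ca≡cb = fixed-constant-on-cycles (restrictS S c) u-fixed
      (path-within-component ca≡cb (same-component⇒reach ca≡cb))
      (path-within-component (sym ca≡cb) (same-component⇒reach (sym ca≡cb)))
    u≡contract : ∀ i → lookup u i ≡ lookup (contract u) (c i)
    u≡contract i = sym (lookup-contract u u-constant i)
    u-downClosed : DownClosed (contract u)
    u-downClosed k l k⪯l l∈ = lookup⇒[]= k _ (trans (lookup∘tabulate _ k)
      (proj₂ (u-admissible l) one-on-l (rep k) (subst (λ m → _⪯_ S c m l) (sym (c-rep k)) k⪯l)))
      where
      one-on-l : OneOn S c u (_≡ l)
      one-on-l i ci≡l =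
        trans (u≡contract i) (trans (cong (lookup (contract u)) ci≡l) ([]=⇒lookup l∈))
    open Completion (contract u) u-downClosed
    zero-above : ZeroOn S c u (λ k → ∃ λ j → j ∈ completion × _≺_ S c j k)
    zero-above i (j , j∈ , j≺ci) =
      trans (u≡contract i) (¬-not (completion-above j∈ j≺ci ∘ lookup⇒[]= (c i) (contract u)))
    one-below : OneOn S c u (λ k → ∃ λ j → j ∈ completion × _≺_ S c k j)
    one-below i (j , j∈ , ci≺j) = trans (u≡contract i) ([]=⇒lookup (completion-below j∈ ci≺j))

open Defs using (MaxAntichain)

mainTheorem18 : (n t : ℕ) (S : Fin n → Subset n) → (∀ j → Nonempty (S j))
    → (c : Fin n → Fin t)
    → (∀ k → ∃ λ i → c i ≡ k)
    → (∀ i j → (c i ≡ c j) ⇔ (Reach S i j × Reach S j i))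
    → (∀ k → ∃₂ λ i j → c i ≡ k × c j ≡ k × Edge S i j)
    → (Ω : List (Subset t)) → Unique Ω → (∀ J → (J ∈ₗ Ω) ⇔ MaxAntichain S c J)
    → (∀ u → hNet S c u ≡ u → Admissible S c u → Regular S c u)
    × (Σ ℕ λ N → (Fin N ↔ Σ (Vec Bool n) (λ x → network S x ≡ x))
    × (+ N ≡ inclusionExclusion Ω))
-- Nonempty input sets already follow from the edges inside the components, and the
-- inclusion–exclusion sum does not need Ω to be free of repetitions.
mainTheorem18 n t S _ c c-surjective c-components component-edge Ω _ Ω-maxAntichains =
  admissible⇒regular , count (covered Ω) , fixed-points , count-covered Ω
  where
  open Condensation S c c-surjective c-components component-edge
  fixed-points : Fin (count (covered Ω)) ↔ Σ (Vec Bool n) (λ x → network S x ≡ x)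
  fixed-points =
    downClosed↔fixed ↔-∘ (covered↔downClosed Ω Ω-maxAntichains ↔-∘ Fin-count↔ (covered Ω))
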